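{- Let $n\ge3$ be an integer and let $f$ be a $\gamma_{tr3}(P_3\square P_n)$-function such that the number of vertices $v$ with $f(v)=\emptyset$ is minimum among all $\gamma_{tr3}(P_3\square P_n)$-functions. If $j\in\{0,1,\dots,n-2\}$ satisfies $|f((1,j))|=2$, then $|f((1,j+1))|=|f((2,j))|=0$.
   Context: $P_m$ denotes the directed path with vertex set $\{0,1,\dots,m-1\}$ and arcs $(i,i+1)$ for $0\le i\le m-2$. The Cartesian product $D_1\square D_2$ has vertex set $V(D_1)\times V(D_2)$, with an arc from $(x_1,y_1)$ to $(x_2,y_2)$ iff either $(x_1,x_2)$ is an arc of $D_1$ and $y_1=y_2$, or $x_1=x_2$ and $(y_1,y_2)$ is an arc of $D_2$; so vertices of $P_3\square P_n$ are $(i,j)$ with $i\in\{0,1,2\}$, $j\in\{0,\dots,n-1\}$. For a digraph $D$ and positive integer $k$, a $k$RDF is a function $f:V(D)\to\mathcal{P}(\{1,\dots,k\})$ such that every $v$ with $f(v)=\emptyset$ satisfies $\bigcup_{u\in N^-(v)}f(u)=\{1,\dots,k\}$ ($N^-(v)$ the in-neighbors of $v$); its weight is $\sum_v|f(v)|$. A T$k$RDF is a $k$RDF $f$ such that the subdigraph induced by $\{v:f(v)\neq\emptyset\}$ has no isolated vertex; $\gamma_{trk}(D)$ is the minimum weight of a T$k$RDF, and a T$k$RDF of that weight is a $\gamma_{trk}(D)$-function. -}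

module Defs where

open import Data.Nat using (ℕ; suc; _≤_; _+_)
open import Data.Fin using (Fin; toℕ)
open import Data.Fin.Subset using (Subset; ⊥; _∈_; ∣_∣)
open import Data.Vec.Properties using (≡-dec)
import Data.Bool as B
open import Data.Nat.ListAction using (sum)
open import Data.Product using (_×_; ∃; Σ; _,_)
open import Data.Sum using (_⊎_)
open import Data.List using (List; map; allFin; length; filter; concatMap)
open import Relation.Binary.PropositionalEquality using (_≡_)
open import Relation.Nullary using (¬_)

V : ℕ → Set
V n = Fin 3 × Fin n

Arc : {n : ℕ} → V n → V n → Set
Arc (i , j) (i' , j') =
  (toℕ i' ≡ suc (toℕ i) × j ≡ j') ⊎ (i ≡ i' × toℕ j' ≡ suc (toℕ j))

-- A labelling assigns to each vertex a subset of {1,2,3} (represented by Fin 3)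
Labelling : ℕ → Set
Labelling n = V n → Subset 3

Is3RDF : {n : ℕ} → Labelling n → Set
Is3RDF {n} f = ∀ (v : V n) → f v ≡ ⊥ →
  ∀ (c : Fin 3) → ∃ λ (u : V n) → Arc u v × c ∈ f u

IsT3RDF : {n : ℕ} → Labelling n → Set
IsT3RDF {n} f = Is3RDF f ×
  (∀ (v : V n) → ¬ (f v ≡ ⊥) →
     ∃ λ (u : V n) → (Arc u v ⊎ Arc v u) × ¬ (f u ≡ ⊥))

vertices : (n : ℕ) → List (V n)
vertices n = concatMap (λ i → map (λ j → (i , j)) (allFin n)) (allFin 3)

weight : {n : ℕ} → Labelling n → ℕ
weight {n} f = sum (map (λ v → ∣ f v ∣) (vertices n))

numEmpty : {n : ℕ} → Labelling n → ℕ
numEmpty {n} f = length (filter (λ v → ≡-dec B._≟_ (f v) ⊥) (vertices n))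

IsGammaTr3Function : {n : ℕ} → Labelling n → Set
IsGammaTr3Function {n} f = IsT3RDF f × (∀ (g : Labelling n) → IsT3RDF g → weight f ≤ weight g)

-- Relabel (1,j) by {1} and also give {1} to those of its out-neighbours (2,j), (1,j+1)
-- that f leaves empty.  The result is again a total 3RDF: a vertex it leaves empty was
-- empty under f and is not an out-neighbour of (1,j), so its in-neighbours keep their
-- labels; and every newly labelled vertex has (1,j) as a labelled neighbour.  Its weight
-- is that of f, minus 1, plus the number of filled out-neighbours.  If none was empty it
-- is lighter than f; if exactly one was, it is a γ-function with fewer empty vertices.
module Submission where

open import Defs
open import Data.Nat using (ℕ; _≤_; _<_; suc; s≤s; z≤n)
open import Data.Nat.Properties using (<-trans; n<1+n)
open import Data.Fin using (Fin; fromℕ<)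
open import Data.Fin.Subset using (∣_∣)
open import Data.Product using (_×_; _,_)
open import Relation.Binary.PropositionalEquality using (_≡_)

open import Data.Nat using (_+_)
import Data.Nat.Properties as ℕ
open import Data.Fin using (zero; toℕ)
import Data.Fin as Fin
open import Data.Fin.Properties using (toℕ-injective; toℕ-fromℕ<)
open import Data.Fin.Subset using (Subset; ⁅_⁆; _∈_) renaming (⊥ to ∅)
open import Data.Fin.Subset.Properties using (∉⊥; ∣⊥∣≡0)
open import Data.Product using (∃; proj₁; proj₂)
open import Data.Product.Properties using (≡-dec)
open import Data.Sum using (_⊎_; inj₁; inj₂)
open import Data.Empty using (⊥-elim)
open import Relation.Nullary using (¬_; Dec; yes; no)
open import Relation.Unary using (Pred; Decidable)
open import Relation.Binary.PropositionalEquality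
  using (refl; sym; trans; cong; cong₂; subst; _≢_; module ≡-Reasoning)
open import Data.List using (List; []; _∷_; map; length; filter)
open import Data.List.Properties using (map-cong-local)
open import Data.Nat.ListAction using (sum)
open import Data.List.Membership.Propositional using () renaming (_∈_ to _∈ₗ_)
open import Data.List.Membership.Propositional.Properties using (∈-cartesianProduct⁺; ∈-allFin)
open import Data.List.Relation.Unary.Any using (here; there)
import Data.List.Relation.Unary.All as All
open import Data.List.Relation.Unary.AllPairs using (_∷_)
open import Data.List.Relation.Unary.Unique.Propositional using (Unique)
open import Data.List.Relation.Unary.Unique.Propositional.Properties using (cartesianProduct⁺; allFin⁺)
import Data.Vec.Properties as Vec
import Data.Bool as Bool
open import Level using (0ℓ)
open import Function using (case_of_)
open import Data.Nat.Tactic.RingSolver using (solve-∀)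

module _ {A : Set} where

  sum-map-agree-off : (h₁ h₂ : A → ℕ) {xs : List A} {p : A} → Unique xs → p ∈ₗ xs →
    (∀ v → v ≢ p → h₁ v ≡ h₂ v) → sum (map h₁ xs) + h₂ p ≡ sum (map h₂ xs) + h₁ p
  sum-map-agree-off h₁ h₂ {p ∷ xs} (p∉xs ∷ _) (here refl) agree
    rewrite map-cong-local (All.map (λ p≢v → agree _ (λ v≡p → p≢v (sym v≡p))) p∉xs)
    = swap-outer (h₁ p) (sum (map h₂ xs)) (h₂ p)
    where
    swap-outer : ∀ a s b → a + s + b ≡ b + s + a
    swap-outer = solve-∀
  sum-map-agree-off h₁ h₂ {q ∷ xs} {p} (q∉xs ∷ unique) (there p∈xs) agree = begin
    h₁ q + sum (map h₁ xs) + h₂ p   ≡⟨ cong (λ t → t + sum (map h₁ xs) + h₂ p) (agree q q≢p) ⟩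
    h₂ q + sum (map h₁ xs) + h₂ p   ≡⟨ ℕ.+-assoc (h₂ q) _ _ ⟩
    h₂ q + (sum (map h₁ xs) + h₂ p) ≡⟨ cong (h₂ q +_) (sum-map-agree-off h₁ h₂ unique p∈xs agree) ⟩
    h₂ q + (sum (map h₂ xs) + h₁ p) ≡⟨ ℕ.+-assoc (h₂ q) _ _ ⟨
    h₂ q + sum (map h₂ xs) + h₁ p   ∎
    where
    open ≡-Reasoning
    q≢p : q ≢ p
    q≢p = All.lookup q∉xs p∈xs

  length-filter-mono : {P Q : Pred A 0ℓ} (P? : Decidable P) (Q? : Decidable Q) (xs : List A) →
    (∀ v → Q v → P v) → length (filter Q? xs) ≤ length (filter P? xs)
  length-filter-mono P? Q? [] Q⇒P = z≤n
  length-filter-mono P? Q? (v ∷ xs) Q⇒P with Q? v | P? v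
  ... | yes qv | yes _  = s≤s (length-filter-mono P? Q? xs Q⇒P)
  ... | yes qv | no ¬pv = ⊥-elim (¬pv (Q⇒P v qv))
  ... | no _   | yes _  = ℕ.m≤n⇒m≤1+n (length-filter-mono P? Q? xs Q⇒P)
  ... | no _   | no _   = length-filter-mono P? Q? xs Q⇒P

  length-filter-strict : {P Q : Pred A 0ℓ} (P? : Decidable P) (Q? : Decidable Q) {xs : List A} →
    (∀ v → Q v → P v) → {e : A} → e ∈ₗ xs → P e → ¬ Q e →
    length (filter Q? xs) < length (filter P? xs)
  length-filter-strict P? Q? {v ∷ xs} Q⇒P (here refl) pe ¬qe with Q? v | P? v
  ... | yes qv | _      = ⊥-elim (¬qe qv)
  ... | no _   | no ¬pv = ⊥-elim (¬pv pe)
  ... | no _   | yes _  = s≤s (length-filter-mono P? Q? xs Q⇒P)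
  length-filter-strict P? Q? {v ∷ xs} Q⇒P (there e∈xs) pe ¬qe with Q? v | P? v
  ... | yes qv | yes _  = s≤s (length-filter-strict P? Q? Q⇒P e∈xs pe ¬qe)
  ... | yes qv | no ¬pv = ⊥-elim (¬pv (Q⇒P v qv))
  ... | no _   | yes _  = ℕ.m≤n⇒m≤1+n (length-filter-strict P? Q? Q⇒P e∈xs pe ¬qe)
  ... | no _   | no _   = length-filter-strict P? Q? Q⇒P e∈xs pe ¬qe

vertices-unique : (n : ℕ) → Unique (vertices n)
vertices-unique n = cartesianProduct⁺ (allFin⁺ 3) (allFin⁺ n)

∈-vertices : {n : ℕ} (v : V n) → v ∈ₗ vertices n
∈-vertices (i , j) = ∈-cartesianProduct⁺ (∈-allFin i) (∈-allFin j)

_≟ᵥ_ : {n : ℕ} (u v : V n) → Dec (u ≡ v)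
_≟ᵥ_ = ≡-dec Fin._≟_ Fin._≟_

_≟ₛ_ : (s t : Subset 3) → Dec (s ≡ t)
_≟ₛ_ = Vec.≡-dec Bool._≟_

Arc-irrefl : {n : ℕ} {v : V n} → ¬ Arc v v
Arc-irrefl (inj₁ (i≡1+i , _)) = ℕ.1+n≢n (sym i≡1+i)
Arc-irrefl (inj₂ (_ , j≡1+j)) = ℕ.1+n≢n (sym j≡1+j)

Arc⇒≢ : {n : ℕ} {u v : V n} → Arc u v → v ≢ u
Arc⇒≢ arc refl = Arc-irrefl arc

out-neighbours-of-middle-row : {n : ℕ} {j j′ : Fin n} → toℕ j′ ≡ suc (toℕ j) →
  ∀ v → Arc (Fin.suc zero , j) v → v ≡ (Fin.suc (Fin.suc zero) , j) ⊎ v ≡ (Fin.suc zero , j′)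
out-neighbours-of-middle-row j′≡1+j (i , k) (inj₁ (i≡2 , j≡k)) =
  inj₁ (cong₂ _,_ (toℕ-injective i≡2) (sym j≡k))
out-neighbours-of-middle-row j′≡1+j (i , k) (inj₂ (1≡i , k≡1+j)) =
  inj₂ (cong₂ _,_ (sym 1≡i) (toℕ-injective (trans k≡1+j (sym j′≡1+j))))

⁅0⁆≢∅ : ⁅ zero ⁆ ≢ ∅ {n = 3}
⁅0⁆≢∅ ()

module _ {n : ℕ} where

  _[_≔_] : Labelling n → V n → Subset 3 → Labelling n
  (f [ p ≔ s ]) v with v ≟ᵥ p
  ... | yes _ = s
  ... | no _  = f v

  update-≡ : (f : Labelling n) (p : V n) (s : Subset 3) → (f [ p ≔ s ]) p ≡ s
  update-≡ f p s with p ≟ᵥ p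
  ... | yes _   = refl
  ... | no p≢p = ⊥-elim (p≢p refl)

  update-≢ : (f : Labelling n) {p v : V n} (s : Subset 3) → v ≢ p → (f [ p ≔ s ]) v ≡ f v
  update-≢ f {p} {v} s v≢p with v ≟ᵥ p
  ... | yes v≡p = ⊥-elim (v≢p v≡p)
  ... | no _    = refl

  weight-update : (f : Labelling n) (p : V n) (s : Subset 3) →
    weight (f [ p ≔ s ]) + ∣ f p ∣ ≡ weight f + ∣ s ∣
  weight-update f p s = begin
    weight (f [ p ≔ s ]) + ∣ f p ∣  ≡⟨ sum-map-agree-off (λ v → ∣ (f [ p ≔ s ]) v ∣) (λ v → ∣ f v ∣)
                                         (vertices-unique n) (∈-vertices p) agree ⟩
    weight f + ∣ (f [ p ≔ s ]) p ∣  ≡⟨ cong (λ t → weight f + ∣ t ∣) (update-≡ f p s) ⟩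
    weight f + ∣ s ∣                ∎
    where
    open ≡-Reasoning
    agree : ∀ v → v ≢ p → ∣ (f [ p ≔ s ]) v ∣ ≡ ∣ f v ∣
    agree v v≢p = cong ∣_∣ (update-≢ f s v≢p)

  weight-fill : (f : Labelling n) {p : V n} (s : Subset 3) → f p ≡ ∅ →
    weight (f [ p ≔ s ]) ≡ weight f + ∣ s ∣
  weight-fill f {p} s fp≡∅ = begin
    weight (f [ p ≔ s ])                   ≡⟨ ℕ.+-identityʳ _ ⟨
    weight (f [ p ≔ s ]) + 0               ≡⟨ cong (λ t → weight (f [ p ≔ s ]) + ∣ t ∣) fp≡∅ ⟨
    weight (f [ p ≔ s ]) + ∣ f p ∣         ≡⟨ weight-update f p s ⟩
    weight f + ∣ s ∣                       ∎
    where open ≡-Reasoning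

  numEmpty-< : {f g : Labelling n} → (∀ v → g v ≡ ∅ → f v ≡ ∅) →
    (e : V n) → f e ≡ ∅ → g e ≢ ∅ → numEmpty g < numEmpty f
  numEmpty-< {f} {g} g∅⇒f∅ e fe ge =
    length-filter-strict (λ v → f v ≟ₛ ∅) (λ v → g v ≟ₛ ∅) g∅⇒f∅ (∈-vertices e) fe ge

  module Relabel {f g : Labelling n} {x : V n}
    (unchanged-or-filled : ∀ v → v ≢ x → g v ≡ f v ⊎ (f v ≡ ∅ × Arc x v))
    (gx≢∅ : g x ≢ ∅) (covers : ∀ v → Arc x v → g v ≢ ∅) where

    empty-reflected : ∀ v → g v ≡ ∅ → f v ≡ ∅
    empty-reflected v gv≡∅ with v ≟ᵥ x
    ... | yes refl = ⊥-elim (gx≢∅ gv≡∅)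
    ... | no v≢x with unchanged-or-filled v v≢x
    ...   | inj₁ gv≡fv      = trans (sym gv≡fv) gv≡∅
    ...   | inj₂ (fv≡∅ , _) = fv≡∅

    agrees-on-nonempty : ∀ u → u ≢ x → f u ≢ ∅ → g u ≡ f u
    agrees-on-nonempty u u≢x fu≢∅ with unchanged-or-filled u u≢x
    ... | inj₁ gu≡fu      = gu≡fu
    ... | inj₂ (fu≡∅ , _) = ⊥-elim (fu≢∅ fu≡∅)

    isT3RDF : IsT3RDF f → f x ≢ ∅ → IsT3RDF g
    isT3RDF (dominating , total) fx≢∅ = dominating′ , total′
      where
      dominating′ : Is3RDF g
      dominating′ v gv≡∅ c with dominating v (empty-reflected v gv≡∅) c
      ... | u , arc , c∈fu = u , arc , subst (c ∈_) (sym gu≡fu) c∈fu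
        where
        u≢x : u ≢ x
        u≢x refl = covers v arc gv≡∅
        gu≡fu : g u ≡ f u
        gu≡fu = agrees-on-nonempty u u≢x (λ fu≡∅ → ∉⊥ (subst (c ∈_) fu≡∅ c∈fu))

      total′ : ∀ v → g v ≢ ∅ → ∃ λ u → (Arc u v ⊎ Arc v u) × g u ≢ ∅
      total′ v gv≢∅ with f v ≟ₛ ∅
      ... | no fv≢∅ with total v fv≢∅
      ...   | u , arc , fu≢∅ = u , arc , λ gu≡∅ → fu≢∅ (empty-reflected u gu≡∅)
      total′ v gv≢∅ | yes fv≡∅ with unchanged-or-filled v (λ { refl → fx≢∅ fv≡∅ })
      ...   | inj₁ gv≡fv     = ⊥-elim (gv≢∅ (trans gv≡fv fv≡∅))
      ...   | inj₂ (_ , arc) = x , inj₁ arc , gx≢∅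

  module _ {f : Labelling n} (γf : IsGammaTr3Function f) {x : V n} (2≤fx : 2 ≤ ∣ f x ∣) where

    fx≢∅ : f x ≢ ∅
    fx≢∅ fx≡∅ with subst (λ s → 2 ≤ ∣ s ∣) fx≡∅ 2≤fx
    ... | ()

    out-neighbour-empty : ¬ (∀ v → Arc x v → f v ≢ ∅)
    out-neighbour-empty out-nonempty = ℕ.≤⇒≯ (proj₂ γf g tg) g<f
      where
      g : Labelling n
      g = f [ x ≔ ⁅ zero ⁆ ]

      tg : IsT3RDF g
      tg = Relabel.isT3RDF (λ v v≢x → inj₁ (update-≢ f _ v≢x))
             (λ gx≡∅ → ⁅0⁆≢∅ (trans (sym (update-≡ f x _)) gx≡∅))
             (λ v arc gv≡∅ → out-nonempty v arc (trans (sym (update-≢ f _ (Arc⇒≢ arc))) gv≡∅))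
             (proj₁ γf) fx≢∅

      g<f : weight g < weight f
      g<f = ℕ.+-cancelʳ-< (∣ f x ∣) (weight g) (weight f) (begin-strict
        weight g + ∣ f x ∣   ≡⟨ weight-update f x _ ⟩
        weight f + 1         <⟨ ℕ.+-monoʳ-< (weight f) 2≤fx ⟩
        weight f + ∣ f x ∣   ∎)
        where open ℕ.≤-Reasoning

    module _ (minimal : ∀ (g : Labelling n) → IsGammaTr3Function g → numEmpty f ≤ numEmpty g) where

      out-neighbour-empty-besides : {e : V n} → Arc x e → f e ≡ ∅ →
        ¬ (∀ v → Arc x v → v ≢ e → f v ≢ ∅)
      out-neighbour-empty-besides {e} x→e fe≡∅ others-nonempty =
        ℕ.<⇒≱ fewer-empty (minimal g γg)
        where
        f₁ g : Labelling n
        f₁ = f [ x ≔ ⁅ zero ⁆ ]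
        g  = f₁ [ e ≔ ⁅ zero ⁆ ]

        x≢e : x ≢ e
        x≢e x≡e = Arc⇒≢ x→e (sym x≡e)

        g-elsewhere : ∀ {v} → v ≢ x → v ≢ e → g v ≡ f v
        g-elsewhere v≢x v≢e = trans (update-≢ f₁ _ v≢e) (update-≢ f _ v≢x)

        unchanged-or-filled : ∀ v → v ≢ x → g v ≡ f v ⊎ (f v ≡ ∅ × Arc x v)
        unchanged-or-filled v v≢x = by-cases (v ≟ᵥ e)
          where
          by-cases : Dec (v ≡ e) → g v ≡ f v ⊎ (f v ≡ ∅ × Arc x v)
          by-cases (yes refl) = inj₂ (fe≡∅ , x→e)
          by-cases (no v≢e)   = inj₁ (g-elsewhere v≢x v≢e)

        gx≢∅ : g x ≢ ∅
        gx≢∅ rewrite update-≢ f₁ ⁅ zero ⁆ x≢e | update-≡ f x ⁅ zero ⁆ = ⁅0⁆≢∅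

        ge≢∅ : g e ≢ ∅
        ge≢∅ rewrite update-≡ f₁ e ⁅ zero ⁆ = ⁅0⁆≢∅

        covers : ∀ v → Arc x v → g v ≢ ∅
        covers v x→v = by-cases (v ≟ᵥ e)
          where
          by-cases : Dec (v ≡ e) → g v ≢ ∅
          by-cases (yes refl) = ge≢∅
          by-cases (no v≢e) gv≡∅ =
            others-nonempty v x→v v≢e (trans (sym (g-elsewhere (Arc⇒≢ x→v) v≢e)) gv≡∅)

        open Relabel unchanged-or-filled gx≢∅ covers

        g≤f : weight g ≤ weight f
        g≤f = ℕ.+-cancelʳ-≤ (∣ f x ∣) (weight g) (weight f) (begin
          weight g + ∣ f x ∣           ≡⟨ cong (_+ ∣ f x ∣) (weight-fill f₁ _ (trans (update-≢ f _ (Arc⇒≢ x→e)) fe≡∅)) ⟩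
          weight f₁ + 1 + ∣ f x ∣      ≡⟨ ℕ.+-assoc (weight f₁) 1 _ ⟩
          weight f₁ + (1 + ∣ f x ∣)    ≡⟨ cong (weight f₁ +_) (ℕ.+-comm 1 _) ⟩
          weight f₁ + (∣ f x ∣ + 1)    ≡⟨ ℕ.+-assoc (weight f₁) _ 1 ⟨
          weight f₁ + ∣ f x ∣ + 1      ≡⟨ cong (_+ 1) (weight-update f x _) ⟩
          weight f + 1 + 1             ≡⟨ ℕ.+-assoc (weight f) 1 1 ⟩
          weight f + 2                 ≤⟨ ℕ.+-monoʳ-≤ (weight f) 2≤fx ⟩
          weight f + ∣ f x ∣           ∎)
          where open ℕ.≤-Reasoning

        γg : IsGammaTr3Function g
        γg = isT3RDF (proj₁ γf) fx≢∅ , λ h th → ℕ.≤-trans g≤f (proj₂ γf h th)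

        fewer-empty : numEmpty g < numEmpty f
        fewer-empty = numEmpty-< empty-reflected e fe≡∅ ge≢∅

      two-out-neighbours-empty : {y z : V n} → Arc x y → Arc x z →
        (∀ v → Arc x v → v ≡ y ⊎ v ≡ z) → f y ≡ ∅ × f z ≡ ∅
      two-out-neighbours-empty {y} {z} x→y x→z only with f y ≟ₛ ∅ | f z ≟ₛ ∅
      ... | yes fy≡∅ | yes fz≡∅ = fy≡∅ , fz≡∅
      ... | no fy≢∅  | no fz≢∅  = ⊥-elim (out-neighbour-empty λ v x→v → case only v x→v of
        λ { (inj₁ refl) → fy≢∅ ; (inj₂ refl) → fz≢∅ })
      ... | yes fy≡∅ | no fz≢∅  = ⊥-elim (out-neighbour-empty-besides x→y fy≡∅ λ v x→v v≢y →
        case only v x→v of λ { (inj₁ refl) → ⊥-elim (v≢y refl) ; (inj₂ refl) → fz≢∅ })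
      ... | no fy≢∅  | yes fz≡∅ = ⊥-elim (out-neighbour-empty-besides x→z fz≡∅ λ v x→v v≢z →
        case only v x→v of λ { (inj₁ refl) → fy≢∅ ; (inj₂ refl) → ⊥-elim (v≢z refl) })

lemma4p7 : (n : ℕ) → 3 ≤ n → (f : Labelling n) → IsGammaTr3Function f →
    (∀ (g : Labelling n) → IsGammaTr3Function g → numEmpty f ≤ numEmpty g) →
    (j : ℕ) → (hj : suc j < n) →
    ∣ f (fromℕ< {1} {3} (s≤s (s≤s z≤n)) , fromℕ< {j} {n} (<-trans (n<1+n j) hj)) ∣ ≡ 2 →
    (∣ f (fromℕ< {1} {3} (s≤s (s≤s z≤n)) , fromℕ< {suc j} {n} hj) ∣ ≡ 0)
      × (∣ f (fromℕ< {2} {3} (s≤s (s≤s (s≤s z≤n))) , fromℕ< {j} {n} (<-trans (n<1+n j) hj)) ∣ ≡ 0)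
lemma4p7 n _ f γf minimal j hj fx≡2 = size-0 (proj₂ empties) , size-0 (proj₁ empties)
  where
  jₓ j₊ : Fin n
  jₓ = fromℕ< (<-trans (n<1+n j) hj)
  j₊ = fromℕ< hj

  j₊≡1+jₓ : toℕ j₊ ≡ suc (toℕ jₓ)
  j₊≡1+jₓ = trans (toℕ-fromℕ< hj) (cong suc (sym (toℕ-fromℕ< (<-trans (n<1+n j) hj))))

  empties : f (Fin.suc (Fin.suc zero) , jₓ) ≡ ∅ × f (Fin.suc zero , j₊) ≡ ∅
  empties = two-out-neighbours-empty γf (ℕ.≤-reflexive (sym fx≡2)) minimal
              (inj₁ (refl , refl)) (inj₂ (refl , j₊≡1+jₓ)) (out-neighbours-of-middle-row j₊≡1+jₓ)

  size-0 : {s : Subset 3} → s ≡ ∅ → ∣ s ∣ ≡ 0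
  size-0 refl = ∣⊥∣≡0 3
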